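{- Let $q$ be a prime power and $k$ a non-negative integer. Let $M$ be a simple $GF(q)$-matroid with no coloops that has two $k$-loose elements $e$ and $f$. Then $r(M) \leq (q+1)(k-1)+2q$, or $\{e,f\}$ is a cocircuit of $M$.
   Context: A $GF(q)$-matroid is a matroid representable over the field with $q$ elements. For a matroid $M$ of rank $r$ and a non-negative integer $k$, an element $t$ of $M$ is called $k$-loose if every circuit of $M$ that contains $t$ has size greater than $r-k$. A matroid is simple if it has no loops and no parallel pairs. -}

module Defs where

open import Level using (Level; _⊔_)
open import Data.Nat using (ℕ; zero; suc; _≤_; _<_; _∸_; _^_)
open import Data.Nat.Primality using (Prime)
open import Data.Fin using (Fin; zero; suc)
open import Data.Fin.Subset using (Subset; _∈_; _∉_; _⊆_; ∣_∣; ⁅_⁆; _∪_)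
open import Data.Product using (Σ; ∃; _×_)
open import Relation.Nullary using (¬_)
open import Relation.Binary.PropositionalEquality using (_≡_)
open import Algebra.Bundles using (CommutativeRing)

IsPrimePower : ℕ → Set
IsPrimePower q = ∃ λ p → ∃ λ m → Prime p × q ≡ p ^ suc m

module _ {c ℓ : Level} (F : CommutativeRing c ℓ) where
  open CommutativeRing F using (Carrier; _≈_; _+_; _*_; 0#; 1#)

  IsField : Set (c ⊔ ℓ)
  IsField = (¬ (1# ≈ 0#)) × (∀ x → ¬ (x ≈ 0#) → ∃ λ y → x * y ≈ 1#)

  HasSize : ℕ → Set (c ⊔ ℓ)
  HasSize q = Σ (Fin q → Carrier) λ enum →
                (∀ i j → enum i ≈ enum j → i ≡ j) × (∀ x → ∃ λ i → enum i ≈ x)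

  sumFin : ∀ {n} → (Fin n → Carrier) → Carrier
  sumFin {zero}  g = 0#
  sumFin {suc n} g = g zero + sumFin (λ i → g (suc i))

  -- The vector matroid M[A] on ground set Fin n, where A i ∈ F^m is the
  -- column of the representing m × n matrix corresponding to element i.
  module VectorMatroid {m n : ℕ} (A : Fin n → Fin m → Carrier) where

    Dependent : Subset n → Set (c ⊔ ℓ)
    Dependent S = Σ (Fin n → Carrier) λ coef →
        (∀ i → i ∉ S → coef i ≈ 0#)
      × (∃ λ i → i ∈ S × ¬ (coef i ≈ 0#))
      × (∀ j → sumFin (λ i → coef i * A i j) ≈ 0#)

    Independent : Subset n → Set (c ⊔ ℓ)
    Independent S = ¬ Dependent S

    Circuit : Subset n → Set (c ⊔ ℓ)
    Circuit C = Dependent C × (∀ D → D ⊆ C → Dependent D → C ⊆ D)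

    Basis : Subset n → Set (c ⊔ ℓ)
    Basis B = Independent B × (∀ S → Independent S → B ⊆ S → S ⊆ B)

    HasRank : ℕ → Set (c ⊔ ℓ)
    HasRank r = (∃ λ S → Independent S × ∣ S ∣ ≡ r)
              × (∀ S → Independent S → ∣ S ∣ ≤ r)

    MeetsAllBases : Subset n → Set (c ⊔ ℓ)
    MeetsAllBases D = ∀ B → Basis B → ∃ λ x → x ∈ D × x ∈ B

    Cocircuit : Subset n → Set (c ⊔ ℓ)
    Cocircuit D = MeetsAllBases D × (∀ D' → D' ⊆ D → MeetsAllBases D' → D ⊆ D')

    IsLoop : Fin n → Set (c ⊔ ℓ)
    IsLoop e = Circuit (⁅ e ⁆)

    IsParallelPair : Fin n → Fin n → Set (c ⊔ ℓ)
    IsParallelPair e f = ¬ (e ≡ f) × Circuit (⁅ e ⁆ ∪ ⁅ f ⁆)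

    Simple : Set (c ⊔ ℓ)
    Simple = (∀ e → ¬ IsLoop e) × (∀ e f → ¬ IsParallelPair e f)

    IsColoop : Fin n → Set (c ⊔ ℓ)
    IsColoop e = ∀ B → Basis B → e ∈ B

    NoColoops : Set (c ⊔ ℓ)
    NoColoops = ∀ e → ¬ IsColoop e

    KLoose : ℕ → ℕ → Fin n → Set (c ⊔ ℓ)
    KLoose r k t = ∀ C → Circuit C → t ∈ C → r ∸ k < ∣ C ∣

{-# OPTIONS --safe #-}
module Submission where

-- Suppose r ≥ (q + 1) k + q and some basis B avoids e and f. Then B ∪ {e} and B ∪ {f} carry
-- linear relations c through e and d through f, and d vanishes at e. Each of the q + 1
-- vectors d and c + ν d (ν ∈ F) is a relation through f or e, so its support contains a
-- circuit through that element and, by looseness, has more than r − k elements. But all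
-- of them are supported on B ∪ {e, f}, and in every coordinate at most q of them are
-- nonzero (if d i ≠ 0 exactly one ν kills c i + ν d i), so their total weight is at most
-- q (|B| + 2) ≤ q (r + 2). This forces r < (q + 1) k + q. Hence every basis meets {e, f},
-- and since neither e nor f is a coloop, {e, f} is a cocircuit.

open import Defs
open import Level using (Level; _⊔_)
open import Algebra.Bundles using (CommutativeRing)
open import Data.Bool using (Bool; true; false; not)
open import Data.Empty using (⊥; ⊥-elim)
open import Data.Fin using (Fin; zero; suc; _≟_)
open import Data.Fin.Subset using (Subset; inside; outside; _∈_; _∉_; _⊆_; ∣_∣; ⁅_⁆; _∪_; ⊤)
open import Data.Fin.Subset.Properties
  using (_∈?_; x∈⁅x⁆; x∈⁅y⁆⇒x≡y; x∈p∪q⁻; x∈p∪q⁺; p⊆p∪q; q⊆p∪q; ∪-comm; drop-there; ⊆⊤; ∈⊤; ∣⊤∣≡n;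
         ∣⁅x⁆∣≡1; ∣p∣≤n; ∣p∣≤∣x∷p∣; p⊂q⇒∣p∣<∣q∣)
open import Data.Nat using (ℕ; suc)
import Data.Nat as ℕ
open import Data.Product using (∃; _×_; _,_; proj₁; proj₂)
open import Data.Sum using (_⊎_; inj₁; inj₂; [_,_])
open import Data.Vec using (_∷_; []; tabulate)
open import Data.Vec.Properties using (lookup∘tabulate; []=⇒lookup; lookup⇒[]=)
open import Function using (_∘_)
open import Relation.Binary.Definitions using (Decidable)
open import Relation.Nullary using (¬_; Dec; yes; no; does)
open import Relation.Nullary.Decidable using (dec-true; dec-false; decidable-stable)
open import Relation.Binary.PropositionalEquality as ≡ using (_≡_)
import Algebra.Properties.Semiring.Sum as Sum

∉∪⁅⁆ : ∀ {n} {p : Subset n} {x y} → x ∉ p → ¬ x ≡ y → x ∉ p ∪ ⁅ y ⁆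
∉∪⁅⁆ {p = p} {y = y} x∉p x≢y x∈ = [ x∉p , x≢y ∘ x∈⁅y⁆⇒x≡y y ] (x∈p∪q⁻ p ⁅ y ⁆ x∈)

∪-monoʳ-⊆ : ∀ {n} (p : Subset n) {q r} → q ⊆ r → p ∪ q ⊆ p ∪ r
∪-monoʳ-⊆ p {q} q⊆r x∈ = [ p⊆p∪q _ , q⊆p∪q p _ ∘ q⊆r ] (x∈p∪q⁻ p q x∈)

module Counting where
  open import Data.Nat using (zero; _+_; _*_; _∸_; _≤_; _<_; _≤?_; z≤n; s≤s)
  open import Data.Nat.Properties
    using (+-*-semiring; module ≤-Reasoning; ≤-trans; ≤-reflexive; ≰⇒>; m≤m+n; m+[n∸m]≡n; +-comm; +-assoc;
           +-suc; *-suc; +-mono-≤; +-monoʳ-≤; +-monoʳ-<; +-cancelˡ-≤)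
  open import Algebra.Properties.Semiring.Sum +-*-semiring using (sum-syntax)

  𝟙 : Bool → ℕ
  𝟙 true  = 1
  𝟙 false = 0

  ∣tabulate∣≡∑𝟙 : ∀ {n} (b : Fin n → Bool) → ∣ tabulate b ∣ ≡ ∑[ i < n ] 𝟙 (b i)
  ∣tabulate∣≡∑𝟙 {zero}  b = ≡.refl
  ∣tabulate∣≡∑𝟙 {suc n} b with b zero
  ... | true  = ≡.cong suc (∣tabulate∣≡∑𝟙 (b ∘ suc))
  ... | false = ∣tabulate∣≡∑𝟙 (b ∘ suc)

  ∣p∪q∣≤∣p∣+∣q∣ : ∀ {n} (p q : Subset n) → ∣ p ∪ q ∣ ≤ ∣ p ∣ + ∣ q ∣
  ∣p∪q∣≤∣p∣+∣q∣ []            []            = z≤n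
  ∣p∪q∣≤∣p∣+∣q∣ (inside  ∷ p) (s ∷ q)       =
    s≤s (≤-trans (∣p∪q∣≤∣p∣+∣q∣ p q) (+-monoʳ-≤ ∣ p ∣ (∣p∣≤∣x∷p∣ s q)))
  ∣p∪q∣≤∣p∣+∣q∣ (outside ∷ p) (inside  ∷ q) =
    ≤-trans (s≤s (∣p∪q∣≤∣p∣+∣q∣ p q)) (≤-reflexive (≡.sym (+-suc ∣ p ∣ ∣ q ∣)))
  ∣p∪q∣≤∣p∣+∣q∣ (outside ∷ p) (outside ∷ q) = ∣p∪q∣≤∣p∣+∣q∣ p q

  *≤∑ : ∀ {n a} (N : Fin n → ℕ) → (∀ i → a ≤ N i) → n * a ≤ ∑[ i < n ] N i
  *≤∑ {zero}  N a≤N = z≤n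
  *≤∑ {suc n} N a≤N = +-mono-≤ (a≤N zero) (*≤∑ (N ∘ suc) (a≤N ∘ suc))

  ∑≤*∣U∣ : ∀ {n q} (N : Fin n → ℕ) (U : Subset n) →
          (∀ i → N i ≤ q) → (∀ i → i ∉ U → N i ≡ 0) → ∑[ i < n ] N i ≤ q * ∣ U ∣
  ∑≤*∣U∣ N [] N≤q off = z≤n
  ∑≤*∣U∣ {suc n} {q} N (inside ∷ U) N≤q off = begin
    N zero + ∑[ i < n ] N (suc i) ≤⟨ +-mono-≤ (N≤q zero) (∑≤*∣U∣ (N ∘ suc) U (N≤q ∘ suc) off-tail) ⟩
    q + q * ∣ U ∣                  ≡⟨ ≡.sym (*-suc q ∣ U ∣) ⟩
    q * suc ∣ U ∣                  ∎
    where
    open ≤-Reasoning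
    off-tail : ∀ i → i ∉ U → N (suc i) ≡ 0
    off-tail i i∉ = off (suc i) (i∉ ∘ drop-there)
  ∑≤*∣U∣ {suc n} {q} N (outside ∷ U) N≤q off = begin
    N zero + ∑[ i < n ] N (suc i) ≡⟨ ≡.cong (_+ ∑[ i < n ] N (suc i)) (off zero (λ ())) ⟩
    ∑[ i < n ] N (suc i)           ≤⟨ ∑≤*∣U∣ (N ∘ suc) U (N≤q ∘ suc) off-tail ⟩
    q * ∣ U ∣                      ∎
    where
    open ≤-Reasoning
    off-tail : ∀ i → i ∉ U → N (suc i) ≡ 0
    off-tail i i∉ = off (suc i) (i∉ ∘ drop-there)

  rank-bound : ∀ q k r → suc q * suc (r ∸ k) ≤ q * (r + 2) → r < suc q * k + q
  rank-bound q k r bound with k ≤? r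
  ... | no k≰r  = ≤-trans (≰⇒> k≰r) (≤-trans (m≤m+n k (q * k)) (m≤m+n (suc q * k) q))
  ... | yes k≤r = begin-strict
      r                ≡⟨ ≡.sym (m+[n∸m]≡n k≤r) ⟩
      k + t            <⟨ +-monoʳ-< k t<qk+q ⟩
      k + (q * k + q)  ≡⟨ ≡.sym (+-assoc k (q * k) q) ⟩
      suc q * k + q    ∎
    where
    open ≤-Reasoning
    open import Data.Nat.Tactic.RingSolver using (solve-∀)
    t = r ∸ k
    expand : ∀ q k t → q * (k + t + 2) ≡ q * suc t + (q * k + q)
    expand = solve-∀
    t<qk+q : t < q * k + q
    t<qk+q = +-cancelˡ-≤ (q * suc t) _ _ (begin
      q * suc t + suc t       ≡⟨ +-comm (q * suc t) (suc t) ⟩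
      suc q * suc t           ≤⟨ bound ⟩
      q * (r + 2)             ≡⟨ ≡.cong (λ x → q * (x + 2)) (≡.sym (m+[n∸m]≡n k≤r)) ⟩
      q * (k + t + 2)         ≡⟨ expand q k t ⟩
      q * suc t + (q * k + q) ∎)

module _ {c ℓ : Level} (F : CommutativeRing c ℓ) where
  open CommutativeRing F using (_≈_; sym; trans)

  ≈-decidable : ∀ {q} → HasSize F q → Decidable _≈_
  ≈-decidable (enum , injective , surjective) x y with surjective x | surjective y
  ... | i , enum-i≈x | j , enum-j≈y with i ≟ j
  ...   | yes ≡.refl = yes (trans (sym enum-i≈x) enum-j≈y)
  ...   | no i≢j     = no (λ x≈y → i≢j (injective i j (trans enum-i≈x (trans x≈y (sym enum-j≈y)))))

module LinearAlgebra {c ℓ : Level} (F : CommutativeRing c ℓ) (isField : IsField F)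
                     (_≈?_ : Decidable (CommutativeRing._≈_ F)) where
  open CommutativeRing F hiding (zero)
  open import Algebra.Properties.Ring ring using (-‿distribˡ-*)
  open import Relation.Binary.Reasoning.Setoid setoid
  open import Data.Nat using (_∸_; _<_; _<?_)
  open import Data.Nat.Properties using (<-trans)
  open import Data.Nat.Induction using (<-rec)
  module ∑F = Sum semiring

  nonzero : Carrier → Bool
  nonzero x = not (does (x ≈? 0#))

  nonzero-≈0 : ∀ {x} → x ≈ 0# → nonzero x ≡ false
  nonzero-≈0 {x} x≈0 = ≡.cong not (dec-true (x ≈? 0#) x≈0)

  nonzero-≉0 : ∀ {x} → ¬ x ≈ 0# → nonzero x ≡ true
  nonzero-≉0 {x} x≉0 = ≡.cong not (dec-false (x ≈? 0#) x≉0)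

  support : ∀ {n} → (Fin n → Carrier) → Subset n
  support g = tabulate (nonzero ∘ g)

  module _ {n : ℕ} {g : Fin n → Carrier} {i : Fin n} where

    ∈support⁺ : ¬ g i ≈ 0# → i ∈ support g
    ∈support⁺ gi≉0 = lookup⇒[]= i (support g) (≡.trans (lookup∘tabulate _ i) (nonzero-≉0 gi≉0))

    ∈support⁻ : i ∈ support g → ¬ g i ≈ 0#
    ∈support⁻ i∈ gi≈0 with ≡.trans (≡.trans (≡.sym ([]=⇒lookup i∈)) (lookup∘tabulate _ i)) (nonzero-≈0 gi≈0)
    ... | ()

    ∉support : i ∉ support g → g i ≈ 0#
    ∉support i∉ = decidable-stable (g i ≈? 0#) (i∉ ∘ ∈support⁺)

  support-⊆ : ∀ {n} {g : Fin n → Carrier} {D} → (∀ i → i ∉ D → g i ≈ 0#) → support g ⊆ D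
  support-⊆ {D = D} g-out {i} i∈ = decidable-stable (i ∈? D) (∈support⁻ i∈ ∘ g-out i)

  line : ∀ {n} → (Fin n → Carrier) → (Fin n → Carrier) → Carrier → Fin n → Carrier
  line c d ν i = c i + ν * d i

  module _ {x y z : Carrier} where

    x+y*z≈x : z ≈ 0# → x + y * z ≈ x
    x+y*z≈x z≈0 = trans (+-congˡ (trans (*-congˡ z≈0) (zeroʳ y))) (+-identityʳ x)

    x+y*z≉0 : z ≈ 0# → ¬ x ≈ 0# → ¬ x + y * z ≈ 0#
    x+y*z≉0 z≈0 x≉0 = x≉0 ∘ trans (sym (x+y*z≈x z≈0))

    x+y*z≈0 : x ≈ 0# → z ≈ 0# → x + y * z ≈ 0#
    x+y*z≈0 x≈0 z≈0 = trans (x+y*z≈x z≈0) x≈0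

  x+y*z-cong : ∀ {x y y′ z} → y ≈ y′ → x + y * z ≈ x + y′ * z
  x+y*z-cong y≈y′ = +-congˡ (*-congʳ y≈y′)

  ∃[y]x+y*z≈0 : ∀ {x z} → ¬ z ≈ 0# → ∃ λ y → x + y * z ≈ 0#
  ∃[y]x+y*z≈0 {x} {z} z≉0 = - (x * z⁻¹) , (begin
      x + - (x * z⁻¹) * z  ≈⟨ +-congˡ (sym (-‿distribˡ-* (x * z⁻¹) z)) ⟩
      x + - (x * z⁻¹ * z)  ≈⟨ +-congˡ (-‿cong x*z⁻¹*z≈x) ⟩
      x + - x              ≈⟨ -‿inverseʳ x ⟩
      0#                   ∎)
    where
    inverse = proj₂ isField z z≉0
    z⁻¹ = proj₁ inverse
    x*z⁻¹*z≈x : x * z⁻¹ * z ≈ x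
    x*z⁻¹*z≈x = trans (*-assoc x z⁻¹ z) (trans (*-congˡ (trans (*-comm z⁻¹ z) (proj₂ inverse))) (*-identityʳ x))

  sumFin≡sum : ∀ {n} (g : Fin n → Carrier) → sumFin F g ≡ ∑F.sum g
  sumFin≡sum {ℕ.zero} g = ≡.refl
  sumFin≡sum {suc n}  g = ≡.cong (g zero +_) (sumFin≡sum (g ∘ suc))

  module Relations {m n : ℕ} (A : Fin n → Fin m → Carrier) where
    open VectorMatroid F A

    IsLinearRelation : (Fin n → Carrier) → Set ℓ
    IsLinearRelation g = ∀ j → sumFin F (λ i → g i * A i j) ≈ 0#

    RelationThrough : Fin n → Subset n → (Fin n → Carrier) → Set ℓ
    RelationThrough t S g = IsLinearRelation g × ¬ g t ≈ 0# × (∀ i → i ∉ S → g i ≈ 0#)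

    line-relation : ∀ {c d} → IsLinearRelation c → IsLinearRelation d → ∀ ν → IsLinearRelation (line c d ν)
    line-relation {c} {d} c-rel d-rel ν j = begin
      sumFin F (λ i → line c d ν i * A i j)  ≡⟨ sumFin≡sum {n} _ ⟩
      ∑F.sum (λ i → line c d ν i * A i j)    ≈⟨ ∑F.sum-cong-≋ distribute ⟩
      ∑F.sum (λ i → cA i + ν * dA i)         ≈⟨ ∑F.∑-distrib-+ cA (λ i → ν * dA i) ⟩
      ∑F.sum cA + ∑F.sum (λ i → ν * dA i)    ≈⟨ +-congˡ (sym (∑F.*-distribˡ-sum ν dA)) ⟩
      ∑F.sum cA + ν * ∑F.sum dA              ≡⟨ ≡.cong₂ (λ u v → u + ν * v) (sumFin≡sum cA) (sumFin≡sum dA) ⟨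
      sumFin F cA + ν * sumFin F dA          ≈⟨ x+y*z≈0 (c-rel j) (d-rel j) ⟩
      0#                                     ∎
      where
      cA dA : Fin n → Carrier
      cA i = c i * A i j
      dA i = d i * A i j
      distribute : ∀ i → line c d ν i * A i j ≈ cA i + ν * dA i
      distribute i = trans (distribʳ (A i j) (c i) (ν * d i)) (+-congˡ (*-assoc ν (d i) (A i j)))

    support-minimal⇒circuit : ∀ {t g} → IsLinearRelation g → ¬ g t ≈ 0# →
      (∀ h → IsLinearRelation h → ¬ h t ≈ 0# → ∣ support h ∣ < ∣ support g ∣ → ⊥) →
      Circuit (support g)
    support-minimal⇒circuit {t} {g} g-rel gt≉0 minimal =
      (g , (λ _ → ∉support) , (t , ∈support⁺ gt≉0 , gt≉0) , g-rel) , minimality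
      where
      no-smaller : ∀ h → IsLinearRelation h → ¬ h t ≈ 0# → (∀ i → i ∉ support g → h i ≈ 0#) →
                   ∀ z → z ∈ support g → h z ≈ 0# → ⊥
      no-smaller h h-rel ht≉0 h-out z z∈ hz≈0 =
        minimal h h-rel ht≉0 (p⊂q⇒∣p∣<∣q∣ (support-⊆ h-out , z , z∈ , λ z∈h → ∈support⁻ z∈h hz≈0))

      minimality : ∀ D → D ⊆ support g → Dependent D → support g ⊆ D
      minimality D D⊆ (d , d-out , (x , x∈D , dx≉0) , d-rel) {y} y∈ =
        decidable-stable (y ∈? D) (shrink (d t ≈? 0#))
        where
        d-out′ : ∀ i → i ∉ support g → d i ≈ 0#
        d-out′ i i∉ = d-out i (i∉ ∘ D⊆)
        shrink : Dec (d t ≈ 0#) → y ∉ D → ⊥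
        shrink (no dt≉0) y∉D = no-smaller d d-rel dt≉0 d-out′ y y∈ (d-out y y∉D)
        -- d misses t, so use it to eliminate the coordinate x of g instead.
        shrink (yes dt≈0) _  = no-smaller (line g d ν) (line-relation g-rel d-rel ν) (x+y*z≉0 dt≈0 gt≉0)
                                 (λ i i∉ → x+y*z≈0 (∉support i∉) (d-out′ i i∉)) x (D⊆ x∈D) gx≈0
          where
          kill = ∃[y]x+y*z≈0 dx≉0
          ν = proj₁ kill
          gx≈0 = proj₂ kill

    kLoose⇒support-large : ∀ {r k t g} → KLoose r k t → IsLinearRelation g → ¬ g t ≈ 0# →
                           r ∸ k < ∣ support g ∣
    kLoose⇒support-large {r} {k} {t} {g} loose g-rel gt≉0 = <-rec P large _ g g-rel gt≉0 ≡.refl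
      where
      P : ℕ → Set (c ⊔ ℓ)
      P N = ∀ g → IsLinearRelation g → ¬ g t ≈ 0# → ∣ support g ∣ ≡ N → r ∸ k < N
      -- A support of size ≤ r ∸ k would be a circuit through t, smaller ones being excluded by induction.
      large : ∀ N → (∀ {M} → M < N → P M) → P N
      large _ ih h h-rel ht≉0 ≡.refl = decidable-stable (r ∸ k <? ∣ support h ∣) λ small →
        small (loose (support h) (support-minimal⇒circuit h-rel ht≉0 λ h′ h′-rel h′t≉0 h′<h →
          small (<-trans (ih h′<h h′ h′-rel h′t≉0 ≡.refl) h′<h)) (∈support⁺ ht≉0))

    -- Only doubly negated: dependence of B ∪ ⁅ a ⁆ is known only as ¬ Independent.
    fundamental-relation : ∀ {B a} → Basis B → a ∉ B → ¬ ¬ ∃ (RelationThrough a (B ∪ ⁅ a ⁆))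
    fundamental-relation {B} {a} (B-indep , B-maximal) a∉B no-relation = extension-dependent (no-relation ∘ relation)
      where
      extension-dependent : ¬ Independent (B ∪ ⁅ a ⁆)
      extension-dependent indep = a∉B (B-maximal _ indep (p⊆p∪q ⁅ a ⁆) (x∈p∪q⁺ (inj₂ (x∈⁅x⁆ a))))
      relation : Dependent (B ∪ ⁅ a ⁆) → ∃ (RelationThrough a (B ∪ ⁅ a ⁆))
      relation (g , g-out , (x , _ , gx≉0) , g-rel) = g , g-rel , ga≉0 , g-out
        where
        ga≉0 : ¬ g a ≈ 0#
        ga≉0 ga≈0 = B-indep (g , g-out-B , (x , x∈B , gx≉0) , g-rel)
          where
          g-out-B : ∀ i → i ∉ B → g i ≈ 0#
          g-out-B i i∉B with i ≟ a
          ... | yes ≡.refl = ga≈0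
          ... | no i≢a     = g-out i (∉∪⁅⁆ i∉B i≢a)
          x∈B : x ∈ B
          x∈B = decidable-stable (x ∈? B) (gx≉0 ∘ g-out-B x)

module LineCounting {c ℓ : Level} (F : CommutativeRing c ℓ) (isField : IsField F) {q : ℕ} (size : HasSize F q) where
  open CommutativeRing F using (Carrier; _≈_; 0#; trans)

  _≈?_ : Decidable _≈_
  _≈?_ = ≈-decidable F size

  open LinearAlgebra F isField _≈?_
  open Counting
  open import Data.Nat using (_+_; _*_; _∸_; _≤_; _<_)
  open import Data.Nat.Properties using (+-*-semiring; module ≤-Reasoning; ≤-trans; +-mono-≤; +-monoˡ-≤; +-monoʳ-≤; *-monoʳ-≤)
  open import Algebra.Properties.Semiring.Sum +-*-semiring using (sum-syntax; sum-cong-≗; sum-replicate-zero; ∑-comm; ∑-distrib-+)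
  open ≤-Reasoning

  enum : Fin q → Carrier
  enum = proj₁ size

  nonzeros-on-line : ∀ {n} → (Fin n → Carrier) → (Fin n → Carrier) → Fin n → ℕ
  nonzeros-on-line c d i = 𝟙 (nonzero (d i)) + ∑[ l < q ] 𝟙 (nonzero (line c d (enum l) i))

  nonzeros-on-line≤q : ∀ {n} (c d : Fin n → Carrier) i → nonzeros-on-line c d i ≤ q
  nonzeros-on-line≤q c d i = bound (d i ≈? 0#)
    where
    coordinate : Fin q → Carrier
    coordinate l = line c d (enum l) i
    count≡ : ∀ b → nonzero (d i) ≡ b → nonzeros-on-line c d i ≡ 𝟙 b + ∣ support coordinate ∣
    count≡ b eq = ≡.cong₂ _+_ (≡.cong 𝟙 eq) (≡.sym (∣tabulate∣≡∑𝟙 (nonzero ∘ coordinate)))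
    bound : Dec (d i ≈ 0#) → nonzeros-on-line c d i ≤ q
    bound (yes di≈0) = begin
      nonzeros-on-line c d i   ≡⟨ count≡ false (nonzero-≈0 di≈0) ⟩
      ∣ support coordinate ∣   ≤⟨ ∣p∣≤n (support coordinate) ⟩
      q                        ∎
    bound (no di≉0) = begin
      nonzeros-on-line c d i      ≡⟨ count≡ true (nonzero-≉0 di≉0) ⟩
      suc ∣ support coordinate ∣  ≤⟨ p⊂q⇒∣p∣<∣q∣ {q = ⊤} (⊆⊤ , l₀ , ∈⊤ , λ l₀∈ → ∈support⁻ l₀∈ killed) ⟩
      ∣ ⊤ {q} ∣                   ≡⟨ ∣⊤∣≡n q ⟩
      q                           ∎
      where
      root = ∃[y]x+y*z≈0 di≉0
      l₀ = proj₁ (proj₂ (proj₂ size) (proj₁ root))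
      killed : coordinate l₀ ≈ 0#
      killed = trans (x+y*z-cong (proj₂ (proj₂ (proj₂ size) (proj₁ root)))) (proj₂ root)

  nonzeros-on-line≡0 : ∀ {n} (c d : Fin n → Carrier) i → c i ≈ 0# → d i ≈ 0# → nonzeros-on-line c d i ≡ 0
  nonzeros-on-line≡0 c d i ci≈0 di≈0 = ≡.cong₂ _+_ (≡.cong 𝟙 (nonzero-≈0 di≈0))
    (≡.trans (sum-cong-≗ {q} (λ l → ≡.cong 𝟙 (nonzero-≈0 (x+y*z≈0 {y = enum l} ci≈0 di≈0)))) (sum-replicate-zero q))

  line-weight : ∀ {n} (c d : Fin n → Carrier) (U : Subset n) →
                (∀ i → i ∉ U → c i ≈ 0#) → (∀ i → i ∉ U → d i ≈ 0#) →
                ∣ support d ∣ + ∑[ l < q ] ∣ support (line c d (enum l)) ∣ ≤ q * ∣ U ∣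
  line-weight {n} c d U c-out d-out = begin
    ∣ support d ∣ + ∑[ l < q ] ∣ support (line c d (enum l)) ∣
      ≡⟨ ≡.cong₂ _+_ (∣tabulate∣≡∑𝟙 (nonzero ∘ d)) (sum-cong-≗ (λ l → ∣tabulate∣≡∑𝟙 (nonzero ∘ line c d (enum l)))) ⟩
    ∑[ i < n ] 𝟙 (nonzero (d i)) + ∑[ l < q ] ∑[ i < n ] 𝟙 (nonzero (line c d (enum l) i))
      ≡⟨ ≡.cong (∑[ i < n ] 𝟙 (nonzero (d i)) +_) (∑-comm (λ l i → 𝟙 (nonzero (line c d (enum l) i)))) ⟩
    ∑[ i < n ] 𝟙 (nonzero (d i)) + ∑[ i < n ] ∑[ l < q ] 𝟙 (nonzero (line c d (enum l) i))
      ≡⟨ ∑-distrib-+ (λ i → 𝟙 (nonzero (d i))) (λ i → ∑[ l < q ] 𝟙 (nonzero (line c d (enum l) i))) ⟨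
    ∑[ i < n ] nonzeros-on-line c d i
      ≤⟨ ∑≤*∣U∣ (nonzeros-on-line c d) U (nonzeros-on-line≤q c d) (λ i i∉ → nonzeros-on-line≡0 c d i (c-out i i∉) (d-out i i∉)) ⟩
    q * ∣ U ∣ ∎

  module _ {m n : ℕ} (A : Fin n → Fin m → Carrier) where
    open VectorMatroid F A
    open Relations A

    loose-pair-bound : ∀ {r k e f B c d} → ¬ e ≡ f → e ∉ B → KLoose r k e → KLoose r k f →
                       RelationThrough e (B ∪ ⁅ e ⁆) c → RelationThrough f (B ∪ ⁅ f ⁆) d →
                       suc q * suc (r ∸ k) ≤ q * (∣ B ∣ + 2)
    loose-pair-bound {r} {k} {e} {f} {B} {c} {d} e≢f e∉B e-loose f-loose
                     (c-rel , ce≉0 , c-out) (d-rel , df≉0 , d-out) = begin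
      suc q * suc (r ∸ k)
        ≤⟨ +-mono-≤ (kLoose⇒support-large {r} {k} f-loose d-rel df≉0) (*≤∑ _ line-large) ⟩
      ∣ support d ∣ + ∑[ l < q ] ∣ support (line c d (enum l)) ∣
        ≤⟨ line-weight c d U (outside-U {c} c-out (∪-monoʳ-⊆ B (p⊆p∪q ⁅ f ⁆)))
                             (outside-U {d} d-out (∪-monoʳ-⊆ B (q⊆p∪q ⁅ e ⁆ ⁅ f ⁆))) ⟩
      q * ∣ U ∣
        ≤⟨ *-monoʳ-≤ q ∣U∣≤∣B∣+2 ⟩
      q * (∣ B ∣ + 2) ∎
      where
      U = B ∪ ⁅ e ⁆ ∪ ⁅ f ⁆
      outside-U : ∀ {g S} → (∀ i → i ∉ S → g i ≈ 0#) → S ⊆ U → ∀ i → i ∉ U → g i ≈ 0#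
      outside-U g-out S⊆U i i∉U = g-out i (i∉U ∘ S⊆U)
      line-large : ∀ l → suc (r ∸ k) ≤ ∣ support (line c d (enum l)) ∣
      line-large l = kLoose⇒support-large {r} {k} e-loose (line-relation c-rel d-rel (enum l))
                       (x+y*z≉0 (d-out e (∉∪⁅⁆ e∉B e≢f)) ce≉0)
      ∣U∣≤∣B∣+2 : ∣ U ∣ ≤ ∣ B ∣ + 2
      ∣U∣≤∣B∣+2 = begin
        ∣ U ∣                              ≤⟨ ∣p∪q∣≤∣p∣+∣q∣ B (⁅ e ⁆ ∪ ⁅ f ⁆) ⟩
        ∣ B ∣ + ∣ ⁅ e ⁆ ∪ ⁅ f ⁆ ∣          ≤⟨ +-monoʳ-≤ ∣ B ∣ (∣p∪q∣≤∣p∣+∣q∣ ⁅ e ⁆ ⁅ f ⁆) ⟩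
        ∣ B ∣ + (∣ ⁅ e ⁆ ∣ + ∣ ⁅ f ⁆ ∣)    ≡⟨ ≡.cong₂ (λ u v → ∣ B ∣ + (u + v)) (∣⁅x⁆∣≡1 e) (∣⁅x⁆∣≡1 f) ⟩
        ∣ B ∣ + 2                          ∎

    basis-meets-loose-pair : ∀ {r k e f} → (∀ S → Independent S → ∣ S ∣ ≤ r) →
                             ¬ e ≡ f → KLoose r k e → KLoose r k f → ¬ r < suc q * k + q →
                             ∀ B → Basis B → e ∉ B → f ∉ B → ⊥
    basis-meets-loose-pair {r} {k} rank-max e≢f e-loose f-loose large B basis e∉B f∉B =
      fundamental-relation basis e∉B λ (c , c-through) →
      fundamental-relation basis f∉B λ (d , d-through) →
      large (rank-bound q k r (≤-trans (loose-pair-bound {r} {k} e≢f e∉B e-loose f-loose c-through d-through)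
                                       (*-monoʳ-≤ q (+-monoˡ-≤ 2 (rank-max B (proj₁ basis))))))

module _ {c ℓ : Level} (F : CommutativeRing c ℓ) {m n : ℕ} (A : Fin n → Fin m → CommutativeRing.Carrier F) where
  open VectorMatroid F A

  pair-member : ∀ {D a b} → D ⊆ ⁅ a ⁆ ∪ ⁅ b ⁆ → MeetsAllBases D → ¬ IsColoop b → a ∈ D
  pair-member {D} {a} {b} D⊆ meets b-free = decidable-stable (a ∈? D) λ a∉D → b-free λ B basis →
    let y , y∈D , y∈B = meets B basis in
    [ (λ y∈a → ⊥-elim (a∉D (≡.subst (_∈ D) (x∈⁅y⁆⇒x≡y a y∈a) y∈D))) , (λ y∈b → ≡.subst (_∈ B) (x∈⁅y⁆⇒x≡y b y∈b) y∈B) ]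
      (x∈p∪q⁻ ⁅ a ⁆ ⁅ b ⁆ (D⊆ y∈D))

  pair-cocircuit : ∀ {e f} → NoColoops → (∀ B → Basis B → e ∉ B → f ∉ B → ⊥) → Cocircuit (⁅ e ⁆ ∪ ⁅ f ⁆)
  pair-cocircuit {e} {f} no-coloops no-basis-avoids = meets , minimal
    where
    meets : MeetsAllBases (⁅ e ⁆ ∪ ⁅ f ⁆)
    meets B basis with e ∈? B | f ∈? B
    ... | yes e∈B | _       = e , x∈p∪q⁺ (inj₁ (x∈⁅x⁆ e)) , e∈B
    ... | no _    | yes f∈B = f , x∈p∪q⁺ (inj₂ (x∈⁅x⁆ f)) , f∈B
    ... | no e∉B  | no f∉B  = ⊥-elim (no-basis-avoids B basis e∉B f∉B)
    minimal : ∀ D → D ⊆ ⁅ e ⁆ ∪ ⁅ f ⁆ → MeetsAllBases D → ⁅ e ⁆ ∪ ⁅ f ⁆ ⊆ D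
    minimal D D⊆ D-meets x∈ with x∈p∪q⁻ ⁅ e ⁆ ⁅ f ⁆ x∈
    ... | inj₁ x∈e = ≡.subst (_∈ D) (≡.sym (x∈⁅y⁆⇒x≡y e x∈e)) (pair-member D⊆ D-meets (no-coloops f))
    ... | inj₂ x∈f = ≡.subst (_∈ D) (≡.sym (x∈⁅y⁆⇒x≡y f x∈f))
                       (pair-member (≡.subst (D ⊆_) (∪-comm ⁅ e ⁆ ⁅ f ⁆) D⊆) D-meets (no-coloops e))

open import Data.Integer using (+_; _-_; _*_; _+_; _≤_)

rank-bound-ℤ : ∀ q k r → r ℕ.< suc q ℕ.* k ℕ.+ q → + r ≤ (+ q + + 1) * (+ k - + 1) + + 2 * + q
rank-bound-ℤ q k r r<N = ≡.subst (+ r ≤_) identity (i<j⇒i≤pred[j] (+<+ r<N))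
  where
  open import Data.Integer using (pred; +<+; -_)
  open import Data.Integer.Properties using (i<j⇒i≤pred[j]; pos-+; pos-*)
  open import Data.Integer.Tactic.RingSolver using (solve-∀)
  open ≡.≡-Reasoning
  expand : ∀ x y → - + 1 + ((+ 1 + x) * y + x) ≡ (x + + 1) * (y - + 1) + + 2 * x
  expand = solve-∀
  identity : pred (+ (suc q ℕ.* k ℕ.+ q)) ≡ (+ q + + 1) * (+ k - + 1) + + 2 * + q
  identity = begin
    pred (+ (suc q ℕ.* k ℕ.+ q))      ≡⟨ ≡.cong pred (pos-+ (suc q ℕ.* k) q) ⟩
    pred (+ (suc q ℕ.* k) + + q)      ≡⟨ ≡.cong (λ x → pred (x + + q)) (pos-* (suc q) k) ⟩
    pred (+ suc q * + k + + q)        ≡⟨ ≡.cong (λ x → pred (x * + k + + q)) (pos-+ 1 q) ⟩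
    pred ((+ 1 + + q) * + k + + q)    ≡⟨ expand (+ q) (+ k) ⟩
    (+ q + + 1) * (+ k - + 1) + + 2 * + q ∎

theorem1p2 : ∀ {c ℓ : Level} (q k : ℕ) → IsPrimePower q →
    (F : CommutativeRing c ℓ) → IsField F → HasSize F q →
    (m n : ℕ) (A : Fin n → Fin m → CommutativeRing.Carrier F) →
    let open VectorMatroid F A in
    Simple → NoColoops →
    (r : ℕ) → HasRank r →
    (e f : Fin n) → ¬ (e ≡ f) → KLoose r k e → KLoose r k f →
    ((+ r) ≤ (+ q + + 1) * (+ k - + 1) + + 2 * + q) ⊎ Cocircuit (⁅ e ⁆ ∪ ⁅ f ⁆)
theorem1p2 q k _ F isField size m n A _ no-coloops r (_ , rank-max) e f e≢f e-loose f-loose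
  with r ℕ.<? suc q ℕ.* k ℕ.+ q
... | yes small = inj₁ (rank-bound-ℤ q k r small)
... | no large  = inj₂ (pair-cocircuit F A no-coloops
                         (LineCounting.basis-meets-loose-pair F isField size A rank-max e≢f e-loose f-loose large))
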